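{- Let $g(x)$ be a power series with $g(0)\neq0$. The vertical half of the Riordan array $\left(g(x),\frac{x}{1-x}\right)$ is $$V=\left(\frac{g(xc(x))}{c(x)\sqrt{1-4x}},\ xc(x)\right),$$ and the horizontal half of $\left(g(x),\frac{x}{1-x}\right)$ is $$H=\left(\frac{g(xc(x))}{c(x)\sqrt{1-4x}},\ xc(x)^2\right).$$
   Context: All power series are formal power series with complex coefficients. A Riordan array is a pair $(g(x),f(x))$ of power series with $g(0)\neq 0$, $f(0)=0$, $f'(0)\neq 0$; it is identified with the infinite lower triangular matrix $(t_{n,k})_{n,k\ge 0}$, $t_{n,k}=[x^n]g(x)f(x)^k$. The vertical half of a Riordan array with matrix $(t_{n,k})$ is the matrix whose $(n,k)$ entry is $t_{2n-k,n}$ (with $t_{i,j}=0$ for $j>i$); the horizontal half is the matrix whose $(n,k)$ entry is $t_{2n,n+k}$. Here $c(x)=\frac{1-\sqrt{1-4x}}{2x}$ is the generating function of the Catalan numbers. -}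

module Defs where

open import Level using (Level)
open import Algebra.Bundles using (CommutativeRing)
open import Data.Nat as ℕ using (ℕ; zero; suc; _∸_; _≤ᵇ_)
open import Data.Nat.Combinatorics using (_C_)
open import Data.Bool using (if_then_else_)
open import Data.List using (List; []; _∷_; map; zipWith; upTo; reverse; foldr)

module PS {c ℓ : Level} (R : CommutativeRing c ℓ) where
  open CommutativeRing R

  Series : Set c
  Series = ℕ → Carrier

  fromℕ : ℕ → Carrier
  fromℕ zero = 0#
  fromℕ (suc n) = 1# + fromℕ n

  Σ≤ : ℕ → (ℕ → Carrier) → Carrier
  Σ≤ zero f = f 0
  Σ≤ (suc n) f = Σ≤ n f + f (suc n)

  _⋆_ : Series → Series → Series
  (a ⋆ b) n = Σ≤ n (λ i → a i * b (n ∸ i))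

  one : Series
  one zero = 1#
  one (suc _) = 0#

  X : Series
  X 1 = 1#
  X _ = 0#

  _⊕_ : Series → Series → Series
  (a ⊕ b) n = a n + b n

  ⊝_ : Series → Series
  (⊝ a) n = - a n

  _^[_] : Series → ℕ → Series
  f ^[ zero ] = one
  f ^[ suc k ] = f ⋆ (f ^[ k ])

  -- multiplicative inverse of a series a with a 0 = 1:
  -- b 0 = 1, b (n+1) = - Σ_{i=1}^{n+1} a i * b (n+1-i).
  -- invList a n = [b n, b (n-1), ..., b 0]
  invList : Series → ℕ → List Carrier
  invList a zero = 1# ∷ []
  invList a (suc n) =
    (- foldr _+_ 0# (zipWith _*_ (map (λ i → a (suc i)) (upTo (suc n))) bs)) ∷ bs
    where bs = invList a n

  inv₁ : Series → Series
  inv₁ a n with invList a n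
  ... | b ∷ _ = b
  ... | [] = 0#

  -- composition g(h(x)) for h 0 = 0
  _∘ₛ_ : Series → Series → Series
  (g ∘ₛ h) n = Σ≤ n (λ k → g k * (h ^[ k ]) n)

  catalan : ℕ → ℕ
  catalan n = ((2 ℕ.* n) C n) ℕ./ suc n

  cS : Series
  cS n = fromℕ (catalan n)

  -- √(1-4x) = 1 - 2 Σ_{n≥1} Cat(n-1) xⁿ   (i.e. 1 - 2x c(x))
  sqrt1m4x : Series
  sqrt1m4x zero = 1#
  sqrt1m4x (suc n) = - fromℕ (2 ℕ.* catalan n)

  riordan : Series → Series → ℕ → ℕ → Carrier
  riordan g f n k = (g ⋆ (f ^[ k ])) n

  Matrix : Set c
  Matrix = ℕ → ℕ → Carrier

  vhalf : Matrix → Matrix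
  vhalf t n k = if k ≤ᵇ 2 ℕ.* n then t (2 ℕ.* n ∸ k) n else 0#

  hhalf : Matrix → Matrix
  hhalf t n k = t (2 ℕ.* n) (n ℕ.+ k)

  xOver1mx : Series
  xOver1mx = X ⋆ inv₁ (one ⊕ (⊝ X))

  dV : Series → Series
  dV g = (g ∘ₛ (X ⋆ cS)) ⋆ inv₁ (cS ⋆ sqrt1m4x)

  _≈ₘ_ : Matrix → Matrix → Set ℓ
  A ≈ₘ B = ∀ n k → A n k ≈ B n k

-- Write U = x c(x), I = 1 / (c(x) √(1-4x)) and f = x/(1-x). Expanding g(x c(x)) in powers of U
-- reduces both halves to the case g = 1, that is, to [xⁿ] Uᵐ I = [xⁱ] fⁿ whenever m + i = 2n.
-- Both sides obey the same Pascal-type recurrence: for fⁿ it comes from (1 - x) f = x, for Uᵐ I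
-- from U² + x = U, which is the Catalan equation c = 1 + x c² (Segner's recurrence, derived from
-- the binomial formula through (n + 2) Cₙ₊₁ = (4n + 2) Cₙ). The recursion ends at i = 0, where
-- both sides vanish, and at m = 0, where I + U = 1 + 2UI (from √(1-4x) = 1 - 2U and c (1 - U) = 1)
-- ties column 0 to column 1, matching binom(2n+1, n) + Cₙ = 2 binom(2n, n) on the other side.
-- The horizontal half is the vertical half read at (n + k, 2k), because U²ᵏ = xᵏ (x c²)ᵏ.

module Submission where

open import Defs
open import Algebra.Bundles using (CommutativeRing)
open import Data.Bool using (true; false)
open import Data.Nat as ℕ using (ℕ; zero; suc; _∸_; _≤_; _<_; _≤′_; z≤n; s≤s; ≤′-refl; ≤′-step)
open import Data.Nat.Properties as ℕ using ()
open import Data.Nat.Combinatorics using (_C_; nCk+nC[k+1]≡[n+1]C[k+1])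
open import Data.Nat.Tactic.RingSolver using (solve-∀)
open import Data.Product using (_×_; _,_)
open import Relation.Binary.PropositionalEquality as ≡ using (_≡_)
open import Relation.Nullary using (¬_)
open import Relation.Nullary.Reflects using (ofʸ; ofⁿ)

-- ℕ-valued copies of PS.Σ≤ and PS.catalan (which live in a ring-parametrised module):
-- the Catalan identities below cancel nonzero integer factors, which a general ring does not allow.
module CatalanNumbers where
  open import Data.Nat
  open import Data.Nat.Properties
  open import Data.Nat.Combinatorics using (_C_; nCk+nC[k+1]≡[n+1]C[k+1]; nCk≡nC[n∸k]; nC1≡n)
  open import Data.Nat.DivMod using (m*n/n≡m)
  open import Data.Nat.Tactic.RingSolver using (solve-∀)
  open import Relation.Binary.PropositionalEquality
  open ≡-Reasoning

  ∑≤ : ℕ → (ℕ → ℕ) → ℕ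
  ∑≤ zero    f = f 0
  ∑≤ (suc n) f = ∑≤ n f + f (suc n)

  ∑≤-cong : ∀ n {f g : ℕ → ℕ} → (∀ i → i ≤ n → f i ≡ g i) → ∑≤ n f ≡ ∑≤ n g
  ∑≤-cong zero    f≡g = f≡g 0 z≤n
  ∑≤-cong (suc n) f≡g =
    cong₂ _+_ (∑≤-cong n (λ i i≤n → f≡g i (m≤n⇒m≤1+n i≤n))) (f≡g (suc n) ≤-refl)

  ∑≤-+ : ∀ n (f g : ℕ → ℕ) → ∑≤ n (λ i → f i + g i) ≡ ∑≤ n f + ∑≤ n g
  ∑≤-+ zero    f g = refl
  ∑≤-+ (suc n) f g = begin
    ∑≤ n (λ i → f i + g i) + (f (suc n) + g (suc n))   ≡⟨ cong (_+ (f (suc n) + g (suc n))) (∑≤-+ n f g) ⟩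
    (∑≤ n f + ∑≤ n g) + (f (suc n) + g (suc n))        ≡⟨ +-+-comm (∑≤ n f) _ _ _ ⟩
    (∑≤ n f + f (suc n)) + (∑≤ n g + g (suc n))        ∎
    where
    +-+-comm : ∀ a b c d → (a + b) + (c + d) ≡ (a + c) + (b + d)
    +-+-comm = solve-∀

  *-∑≤ : ∀ n a (f : ℕ → ℕ) → a * ∑≤ n f ≡ ∑≤ n (λ i → a * f i)
  *-∑≤ zero    a f = refl
  *-∑≤ (suc n) a f = trans (*-distribˡ-+ a _ _) (cong (_+ a * f (suc n)) (*-∑≤ n a f))

  ∑≤-suc : ∀ n (f : ℕ → ℕ) → ∑≤ (suc n) f ≡ f 0 + ∑≤ n (λ i → f (suc i))
  ∑≤-suc zero    f = refl
  ∑≤-suc (suc n) f = trans (cong (_+ f (suc (suc n))) (∑≤-suc n f)) (+-assoc (f 0) _ _)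

  ∑≤-reverse : ∀ n (f : ℕ → ℕ) → ∑≤ n f ≡ ∑≤ n (λ i → f (n ∸ i))
  ∑≤-reverse zero    f = refl
  ∑≤-reverse (suc n) f = begin
    ∑≤ n f + f (suc n)                       ≡⟨ +-comm (∑≤ n f) _ ⟩
    f (suc n) + ∑≤ n f                       ≡⟨ cong (f (suc n) +_) (∑≤-reverse n f) ⟩
    f (suc n) + ∑≤ n (λ i → f (n ∸ i))       ≡⟨ ∑≤-suc n (λ i → f (suc n ∸ i)) ⟨
    ∑≤ (suc n) (λ i → f (suc n ∸ i))         ∎

  [k+l]Ck≡[k+l]Cl : ∀ k l → (k + l) C k ≡ (k + l) C l
  [k+l]Ck≡[k+l]Cl k l = trans (nCk≡nC[n∸k] (m≤m+n k l)) (cong ((k + l) C_) (m+n∸m≡n k l))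

  [1+k]*[1+n]C[1+k]≡[1+n]*nCk : ∀ n k → suc k * (suc n C suc k) ≡ suc n * (n C k)
  [1+k]*[1+n]C[1+k]≡[1+n]*nCk zero    zero    = refl
  [1+k]*[1+n]C[1+k]≡[1+n]*nCk zero    (suc k) = *-zeroʳ (suc (suc k))
  [1+k]*[1+n]C[1+k]≡[1+n]*nCk (suc n) zero    =
    trans (+-identityʳ _) (trans (nC1≡n (suc (suc n))) (sym (*-identityʳ _)))
  [1+k]*[1+n]C[1+k]≡[1+n]*nCk (suc n) (suc k) = begin
    (2 + k) * ((2 + n) C (2 + k))                  ≡⟨ cong ((2 + k) *_) (nCk+nC[k+1]≡[n+1]C[k+1] (suc n) (suc k)) ⟨
    (2 + k) * (A + B)                              ≡⟨ lhs-split k A B ⟩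
    ((1 + k) * A + A) + (2 + k) * B                ≡⟨ cong₂ (λ x y → (x + A) + y)
                                                         ([1+k]*[1+n]C[1+k]≡[1+n]*nCk n k)
                                                         ([1+k]*[1+n]C[1+k]≡[1+n]*nCk n (suc k)) ⟩
    ((1 + n) * (n C k) + A) + (1 + n) * (n C suc k) ≡⟨ rhs-join n (n C k) A (n C suc k) ⟩
    (1 + n) * (n C k + n C suc k) + A              ≡⟨ cong (λ x → (1 + n) * x + A) (nCk+nC[k+1]≡[n+1]C[k+1] n k) ⟩
    (1 + n) * A + A                                ≡⟨ +-comm ((1 + n) * A) A ⟩
    (2 + n) * A                                    ∎
    where
    A = suc n C suc k
    B = suc n C suc (suc k)
    lhs-split : ∀ k A B → (2 + k) * (A + B) ≡ ((1 + k) * A + A) + (2 + k) * B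
    lhs-split = solve-∀
    rhs-join : ∀ n x A y → ((1 + n) * x + A) + (1 + n) * y ≡ (1 + n) * (x + y) + A
    rhs-join = solve-∀

  catalan : ℕ → ℕ
  catalan n = ((2 * n) C n) / suc n

  [1+n]*[2n]C[1+n]≡n*[2n]Cn : ∀ n → suc n * ((2 * n) C suc n) ≡ n * ((2 * n) C n)
  [1+n]*[2n]C[1+n]≡n*[2n]Cn zero    = refl
  [1+n]*[2n]C[1+n]≡n*[2n]Cn (suc m) = begin
    (2 + m) * ((2 * suc m) C (2 + m))  ≡⟨ cong (λ t → (2 + m) * (t C (2 + m))) 2[1+m]≡1+N ⟩
    (2 + m) * (suc N C (2 + m))        ≡⟨ [1+k]*[1+n]C[1+k]≡[1+n]*nCk N (suc m) ⟩
    suc N * (N C suc m)                ≡⟨ cong (suc N *_) ([k+l]Ck≡[k+l]Cl m (suc m)) ⟨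
    suc N * (N C m)                    ≡⟨ [1+k]*[1+n]C[1+k]≡[1+n]*nCk N m ⟨
    (1 + m) * (suc N C suc m)          ≡⟨ cong (λ t → (1 + m) * (t C suc m)) 2[1+m]≡1+N ⟨
    (1 + m) * ((2 * suc m) C suc m)    ∎
    where
    N = m + suc m
    2[1+m]≡1+N : 2 * suc m ≡ suc N
    2[1+m]≡1+N = lemma m
      where lemma : ∀ m → 2 * suc m ≡ suc (m + suc m)
            lemma = solve-∀

  [2n]C[1+n]≤[2n]Cn : ∀ n → (2 * n) C suc n ≤ (2 * n) C n
  [2n]C[1+n]≤[2n]Cn n = *-cancelˡ-≤ (suc n)
    (≤-trans (≤-reflexive ([1+n]*[2n]C[1+n]≡n*[2n]Cn n)) (*-monoˡ-≤ ((2 * n) C n) (n≤1+n n)))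

  private
    [[2n]Cn∸[2n]C[1+n]]*[1+n]≡[2n]Cn : ∀ n → ((2 * n) C n ∸ (2 * n) C suc n) * suc n ≡ (2 * n) C n
    [[2n]Cn∸[2n]C[1+n]]*[1+n]≡[2n]Cn n = begin
      (b ∸ a) * suc n          ≡⟨ *-distribʳ-∸ (suc n) b a ⟩
      b * suc n ∸ a * suc n    ≡⟨ cong₂ _∸_ (*-comm b (suc n)) (trans (*-comm a (suc n)) ([1+n]*[2n]C[1+n]≡n*[2n]Cn n)) ⟩
      (b + n * b) ∸ n * b      ≡⟨ m+n∸n≡m b (n * b) ⟩
      b                        ∎
      where
      b = (2 * n) C n
      a = (2 * n) C suc n

  catalan≡[2n]Cn∸[2n]C[1+n] : ∀ n → catalan n ≡ (2 * n) C n ∸ (2 * n) C suc n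
  catalan≡[2n]Cn∸[2n]C[1+n] n =
    trans (cong (_/ suc n) (sym ([[2n]Cn∸[2n]C[1+n]]*[1+n]≡[2n]Cn n))) (m*n/n≡m _ (suc n))

  [1+n]*catalan≡[2n]Cn : ∀ n → suc n * catalan n ≡ (2 * n) C n
  [1+n]*catalan≡[2n]Cn n = trans (cong (suc n *_) (catalan≡[2n]Cn∸[2n]C[1+n] n))
                                 (trans (*-comm (suc n) _) ([[2n]Cn∸[2n]C[1+n]]*[1+n]≡[2n]Cn n))

  catalan+[2n]C[1+n]≡[2n]Cn : ∀ n → catalan n + (2 * n) C suc n ≡ (2 * n) C n
  catalan+[2n]C[1+n]≡[2n]Cn n =
    trans (cong (_+ (2 * n) C suc n) (catalan≡[2n]Cn∸[2n]C[1+n] n)) (m∸n+n≡m ([2n]C[1+n]≤[2n]Cn n))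

  [1+2n]Cn+catalan≡[2n]Cn+[2n]Cn : ∀ n → suc (2 * n) C n + catalan n ≡ (2 * n) C n + (2 * n) C n
  [1+2n]Cn+catalan≡[2n]Cn+[2n]Cn n = begin
    suc (2 * n) C n + catalan n        ≡⟨ cong (_+ catalan n) (trans (cong (_C n) 1+2n≡n+[1+n]) ([k+l]Ck≡[k+l]Cl n (suc n))) ⟩
    (n + suc n) C suc n + catalan n    ≡⟨ cong (λ t → t C suc n + catalan n) 1+2n≡n+[1+n] ⟨
    suc (2 * n) C suc n + catalan n    ≡⟨ cong (_+ catalan n) (nCk+nC[k+1]≡[n+1]C[k+1] (2 * n) n) ⟨
    (b + a) + catalan n                ≡⟨ +-assoc b a (catalan n) ⟩
    b + (a + catalan n)                ≡⟨ cong (b +_) (trans (+-comm a (catalan n)) (catalan+[2n]C[1+n]≡[2n]Cn n)) ⟩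
    b + b                              ∎
    where
    b = (2 * n) C n
    a = (2 * n) C suc n
    1+2n≡n+[1+n] : suc (2 * n) ≡ n + suc n
    1+2n≡n+[1+n] = lemma n
      where lemma : ∀ n → suc (2 * n) ≡ n + suc n
            lemma = solve-∀

  catalan-recurrence : ∀ n → (2 + n) * catalan (suc n) ≡ 2 * ((1 + 2 * n) * catalan n)
  catalan-recurrence n = *-cancelˡ-≡ _ _ (suc n) (begin
    (1 + n) * ((2 + n) * catalan (suc n))  ≡⟨ cong ((1 + n) *_) ([1+n]*catalan≡[2n]Cn (suc n)) ⟩
    (1 + n) * ((2 * suc n) C suc n)        ≡⟨ cong (λ t → (1 + n) * (t C suc n)) 2[1+n]≡1+M ⟩
    (1 + n) * (suc M C suc n)              ≡⟨ [1+k]*[1+n]C[1+k]≡[1+n]*nCk M n ⟩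
    suc M * (M C n)                        ≡⟨ cong (λ t → suc M * (t C n)) M≡n+[1+n] ⟩
    suc M * ((n + suc n) C n)              ≡⟨ cong (suc M *_) ([k+l]Ck≡[k+l]Cl n (suc n)) ⟩
    suc M * ((n + suc n) C suc n)          ≡⟨ cong (λ t → suc M * (t C suc n)) M≡n+[1+n] ⟨
    suc M * (M C suc n)                    ≡⟨ regroup₁ n (M C suc n) ⟩
    2 * ((1 + n) * (M C suc n))            ≡⟨ cong (2 *_) ([1+k]*[1+n]C[1+k]≡[1+n]*nCk (2 * n) n) ⟩
    2 * (M * ((2 * n) C n))                ≡⟨ cong (λ t → 2 * (M * t)) ([1+n]*catalan≡[2n]Cn n) ⟨
    2 * (M * ((1 + n) * catalan n))        ≡⟨ regroup₂ n (catalan n) ⟩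
    (1 + n) * (2 * ((1 + 2 * n) * catalan n)) ∎)
    where
    M = suc (2 * n)
    2[1+n]≡1+M : 2 * suc n ≡ suc M
    2[1+n]≡1+M = lemma n
      where lemma : ∀ n → 2 * suc n ≡ suc (suc (2 * n))
            lemma = solve-∀
    M≡n+[1+n] : M ≡ n + suc n
    M≡n+[1+n] = lemma n
      where lemma : ∀ n → suc (2 * n) ≡ n + suc n
            lemma = solve-∀
    regroup₁ : ∀ n x → suc (suc (2 * n)) * x ≡ 2 * ((1 + n) * x)
    regroup₁ = solve-∀
    regroup₂ : ∀ n x → 2 * (suc (2 * n) * ((1 + n) * x)) ≡ (1 + n) * (2 * ((1 + 2 * n) * x))
    regroup₂ = solve-∀

  ∑≤-weighted-convolution : ∀ n (w x : ℕ → ℕ) →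
    2 * ∑≤ n (λ i → w i * (x i * x (n ∸ i))) ≡ ∑≤ n (λ i → (w i + w (n ∸ i)) * (x i * x (n ∸ i)))
  ∑≤-weighted-convolution n w x = begin
    2 * ∑≤ n t                                   ≡⟨ cong (∑≤ n t +_) (+-identityʳ (∑≤ n t)) ⟩
    ∑≤ n t + ∑≤ n t                              ≡⟨ cong (∑≤ n t +_) (trans (∑≤-reverse n t) (∑≤-cong n mirror)) ⟩
    ∑≤ n t + ∑≤ n (λ i → w (n ∸ i) * y i)        ≡⟨ ∑≤-+ n t (λ i → w (n ∸ i) * y i) ⟨
    ∑≤ n (λ i → w i * y i + w (n ∸ i) * y i)     ≡⟨ ∑≤-cong n (λ i _ → sym (*-distribʳ-+ (y i) (w i) (w (n ∸ i)))) ⟩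
    ∑≤ n (λ i → (w i + w (n ∸ i)) * y i)         ∎
    where
    y t : ℕ → ℕ
    y i = x i * x (n ∸ i)
    t i = w i * y i
    mirror : ∀ i → i ≤ n → t (n ∸ i) ≡ w (n ∸ i) * y i
    mirror i i≤n rewrite m∸[m∸n]≡n i≤n = cong (w (n ∸ i) *_) (*-comm (x (n ∸ i)) (x i))

  private
    ∑≤-const-weight : ∀ n c (w y : ℕ → ℕ) → (∀ i → i ≤ n → w i ≡ c) → ∑≤ n (λ i → w i * y i) ≡ c * ∑≤ n y
    ∑≤-const-weight n c w y w≡c = trans (∑≤-cong n (λ i i≤n → cong (_* y i) (w≡c i i≤n))) (sym (*-∑≤ n c y))

  catalan⋆catalan : ℕ → ℕ
  catalan⋆catalan n = ∑≤ n (λ i → catalan i * catalan (n ∸ i))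

  catalan⋆catalan-recurrence : ∀ n →
    (3 + n) * catalan⋆catalan (suc n) ≡ 2 * (catalan (suc n) + (2 + 2 * n) * catalan⋆catalan n)
  catalan⋆catalan-recurrence n = begin
    (3 + n) * catalan⋆catalan (suc n)
      ≡⟨ ∑≤-const-weight (suc n) (3 + n) w₁ (x (suc n)) w₁≡3+n ⟨
    ∑≤ (suc n) (λ i → w₁ i * x (suc n) i)
      ≡⟨ ∑≤-weighted-convolution (suc n) suc catalan ⟨
    2 * ∑≤ (suc n) (λ i → suc i * x (suc n) i)
      ≡⟨ cong (2 *_) (∑≤-suc n (λ i → suc i * x (suc n) i)) ⟩
    2 * (1 * (1 * catalan (suc n)) + T)
      ≡⟨ cong (λ t → 2 * (t + T)) (trans (*-identityˡ (1 * catalan (suc n))) (*-identityˡ (catalan (suc n)))) ⟩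
    2 * (catalan (suc n) + T)
      ≡⟨ cong (λ t → 2 * (catalan (suc n) + t)) (trans (∑≤-cong n step) (sym (*-∑≤ n 2 _))) ⟩
    2 * (catalan (suc n) + 2 * ∑≤ n (λ i → (1 + 2 * i) * x n i))
      ≡⟨ cong (λ t → 2 * (catalan (suc n) + t)) (∑≤-weighted-convolution n (λ i → 1 + 2 * i) catalan) ⟩
    2 * (catalan (suc n) + ∑≤ n (λ i → w₂ i * x n i))
      ≡⟨ cong (λ t → 2 * (catalan (suc n) + t)) (∑≤-const-weight n (2 + 2 * n) w₂ (x n) w₂≡2+2n) ⟩
    2 * (catalan (suc n) + (2 + 2 * n) * catalan⋆catalan n)
      ∎
    where
    x : ℕ → ℕ → ℕ
    x m i = catalan i * catalan (m ∸ i)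
    T = ∑≤ n (λ i → (2 + i) * (catalan (suc i) * catalan (n ∸ i)))
    w₁ w₂ : ℕ → ℕ
    w₁ i = suc i + suc (suc n ∸ i)
    w₂ i = (1 + 2 * i) + (1 + 2 * (n ∸ i))
    w₁≡3+n : ∀ i → i ≤ suc n → w₁ i ≡ 3 + n
    w₁≡3+n i i≤1+n = trans (+-suc (suc i) (suc n ∸ i)) (cong (2 +_) (m+[n∸m]≡n i≤1+n))
    w₂≡2+2n : ∀ i → i ≤ n → w₂ i ≡ 2 + 2 * n
    w₂≡2+2n i i≤n = trans (lemma i (n ∸ i)) (cong (λ t → 2 + 2 * t) (m+[n∸m]≡n i≤n))
      where lemma : ∀ i j → (1 + 2 * i) + (1 + 2 * j) ≡ 2 + 2 * (i + j)
            lemma = solve-∀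
    step : ∀ i → i ≤ n → (2 + i) * (catalan (suc i) * catalan (n ∸ i)) ≡ 2 * ((1 + 2 * i) * x n i)
    step i _ = trans (sym (*-assoc (2 + i) (catalan (suc i)) (catalan (n ∸ i))))
                 (trans (cong (_* catalan (n ∸ i)) (catalan-recurrence i))
                        (lemma (1 + 2 * i) (catalan i) (catalan (n ∸ i))))
      where lemma : ∀ a c d → (2 * (a * c)) * d ≡ 2 * (a * (c * d))
            lemma = solve-∀

  segner : ∀ n → catalan⋆catalan n ≡ catalan (suc n)
  segner zero    = refl
  segner (suc n) = *-cancelˡ-≡ _ _ (3 + n) (begin
    (3 + n) * catalan⋆catalan (suc n)                              ≡⟨ catalan⋆catalan-recurrence n ⟩
    2 * (catalan (suc n) + (2 + 2 * n) * catalan⋆catalan n)        ≡⟨ cong (λ t → 2 * (catalan (suc n) + (2 + 2 * n) * t)) (segner n) ⟩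
    2 * (catalan (suc n) + (2 + 2 * n) * catalan (suc n))          ≡⟨ regroup n (catalan (suc n)) ⟩
    2 * ((1 + 2 * suc n) * catalan (suc n))                        ≡⟨ catalan-recurrence (suc n) ⟨
    (3 + n) * catalan (suc (suc n))                                ∎)
    where
    regroup : ∀ n c → 2 * (c + (2 + 2 * n) * c) ≡ 2 * ((1 + 2 * suc n) * c)
    regroup = solve-∀

module FiniteSums {c ℓ} (R : CommutativeRing c ℓ) where
  open CommutativeRing R
  open PS R
  open import Relation.Binary.Reasoning.Setoid setoid

  Σ≤-cong : ∀ n {f g : ℕ → Carrier} → (∀ i → i ≤ n → f i ≈ g i) → Σ≤ n f ≈ Σ≤ n g
  Σ≤-cong zero    f≈g = f≈g 0 z≤n
  Σ≤-cong (suc n) f≈g = +-cong (Σ≤-cong n (λ i i≤n → f≈g i (ℕ.m≤n⇒m≤1+n i≤n))) (f≈g (suc n) ℕ.≤-refl)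

  Σ≤-+ : ∀ n (f g : ℕ → Carrier) → Σ≤ n (λ i → f i + g i) ≈ Σ≤ n f + Σ≤ n g
  Σ≤-+ zero    f g = refl
  Σ≤-+ (suc n) f g = begin
    Σ≤ n (λ i → f i + g i) + (f (suc n) + g (suc n)) ≈⟨ +-congʳ (Σ≤-+ n f g) ⟩
    (Σ≤ n f + Σ≤ n g) + (f (suc n) + g (suc n))      ≈⟨ +-assoc _ _ _ ⟩
    Σ≤ n f + (Σ≤ n g + (f (suc n) + g (suc n)))      ≈⟨ +-congˡ (x∙yz≈y∙xz _ _ _) ⟩
    Σ≤ n f + (f (suc n) + (Σ≤ n g + g (suc n)))      ≈⟨ +-assoc _ _ _ ⟨
    (Σ≤ n f + f (suc n)) + (Σ≤ n g + g (suc n))      ∎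
    where open import Algebra.Properties.CommutativeSemigroup +-commutativeSemigroup using (x∙yz≈y∙xz)

  *-Σ≤ : ∀ n a (f : ℕ → Carrier) → a * Σ≤ n f ≈ Σ≤ n (λ i → a * f i)
  *-Σ≤ zero    a f = refl
  *-Σ≤ (suc n) a f = trans (distribˡ a _ _) (+-congʳ (*-Σ≤ n a f))

  Σ≤-* : ∀ n a (f : ℕ → Carrier) → Σ≤ n f * a ≈ Σ≤ n (λ i → f i * a)
  Σ≤-* zero    a f = refl
  Σ≤-* (suc n) a f = trans (distribʳ a _ _) (+-congʳ (Σ≤-* n a f))

  Σ≤-zero : ∀ n (f : ℕ → Carrier) → (∀ i → i ≤ n → f i ≈ 0#) → Σ≤ n f ≈ 0#
  Σ≤-zero zero    f f≈0 = f≈0 0 z≤n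
  Σ≤-zero (suc n) f f≈0 =
    trans (+-cong (Σ≤-zero n f (λ i i≤n → f≈0 i (ℕ.m≤n⇒m≤1+n i≤n))) (f≈0 (suc n) ℕ.≤-refl)) (+-identityˡ 0#)

  Σ≤-suc : ∀ n (f : ℕ → Carrier) → Σ≤ (suc n) f ≈ f 0 + Σ≤ n (λ i → f (suc i))
  Σ≤-suc zero    f = refl
  Σ≤-suc (suc n) f = trans (+-congʳ (Σ≤-suc n f)) (+-assoc _ _ _)

  Σ≤-reverse : ∀ n (f : ℕ → Carrier) → Σ≤ n f ≈ Σ≤ n (λ i → f (n ∸ i))
  Σ≤-reverse zero    f = refl
  Σ≤-reverse (suc n) f = begin
    Σ≤ n f + f (suc n)                   ≈⟨ +-comm _ _ ⟩
    f (suc n) + Σ≤ n f                   ≈⟨ +-congˡ (Σ≤-reverse n f) ⟩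
    f (suc n) + Σ≤ n (λ i → f (n ∸ i))   ≈⟨ Σ≤-suc n (λ i → f (suc n ∸ i)) ⟨
    Σ≤ (suc n) (λ i → f (suc n ∸ i))     ∎

  Σ≤-truncate : ∀ {m n} (f : ℕ → Carrier) → (∀ i → m < i → f i ≈ 0#) → m ≤′ n → Σ≤ n f ≈ Σ≤ m f
  Σ≤-truncate f f≈0 ≤′-refl        = refl
  Σ≤-truncate f f≈0 (≤′-step m≤′n) =
    trans (+-cong (Σ≤-truncate f f≈0 m≤′n) (f≈0 _ (s≤s (ℕ.≤′⇒≤ m≤′n)))) (+-identityʳ _)

  Σ≤-dropLeading : ∀ j n (f : ℕ → Carrier) → (∀ i → i < j → f i ≈ 0#) → Σ≤ (j ℕ.+ n) f ≈ Σ≤ n (λ i → f (j ℕ.+ i))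
  Σ≤-dropLeading zero    n f f≈0 = refl
  Σ≤-dropLeading (suc j) n f f≈0 = begin
    Σ≤ (suc (j ℕ.+ n)) f                      ≈⟨ Σ≤-suc (j ℕ.+ n) f ⟩
    f 0 + Σ≤ (j ℕ.+ n) (λ i → f (suc i))       ≈⟨ +-congʳ (f≈0 0 (s≤s z≤n)) ⟩
    0# + Σ≤ (j ℕ.+ n) (λ i → f (suc i))        ≈⟨ +-identityˡ _ ⟩
    Σ≤ (j ℕ.+ n) (λ i → f (suc i))             ≈⟨ Σ≤-dropLeading j n (λ i → f (suc i)) (λ i i<j → f≈0 (suc i) (s≤s i<j)) ⟩
    Σ≤ n (λ i → f (suc (j ℕ.+ i)))             ∎

  Σ≤-Σ≤-swap : ∀ n (F : ℕ → ℕ → Carrier) →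
               Σ≤ n (λ i → Σ≤ i (F i)) ≈ Σ≤ n (λ j → Σ≤ (n ∸ j) (λ m → F (j ℕ.+ m) j))
  Σ≤-Σ≤-swap zero    F = refl
  Σ≤-Σ≤-swap (suc n) F = begin
    Σ≤ n (λ i → Σ≤ i (F i)) + (Σ≤ n (F (suc n)) + F (suc n) (suc n))
      ≈⟨ +-congʳ (Σ≤-Σ≤-swap n F) ⟩
    Σ≤ n (λ j → Σ≤ (n ∸ j) (G j)) + (Σ≤ n (F (suc n)) + F (suc n) (suc n))
      ≈⟨ +-assoc _ _ _ ⟨
    (Σ≤ n (λ j → Σ≤ (n ∸ j) (G j)) + Σ≤ n (F (suc n))) + F (suc n) (suc n)
      ≈⟨ +-congʳ (Σ≤-+ n _ _) ⟨
    Σ≤ n (λ j → Σ≤ (n ∸ j) (G j) + F (suc n) j) + F (suc n) (suc n)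
      ≈⟨ +-cong (Σ≤-cong n extend) (reflexive (≡.cong (λ t → F t (suc n)) (ℕ.+-identityʳ (suc n)))) ⟨
    Σ≤ n (λ j → Σ≤ (suc n ∸ j) (G j)) + G (suc n) 0
      ≈⟨ +-congˡ (reflexive (≡.cong (λ t → Σ≤ t (G (suc n))) (ℕ.n∸n≡0 n))) ⟨
    Σ≤ n (λ j → Σ≤ (suc n ∸ j) (G j)) + Σ≤ (n ∸ n) (G (suc n))
      ∎
    where
    G : ℕ → ℕ → Carrier
    G j m = F (j ℕ.+ m) j
    extend : ∀ j → j ≤ n → Σ≤ (suc n ∸ j) (G j) ≈ Σ≤ (n ∸ j) (G j) + F (suc n) j
    extend j j≤n rewrite ℕ.+-∸-assoc 1 j≤n =
      +-congˡ (reflexive (≡.cong (λ t → F t j) (≡.trans (ℕ.+-suc j (n ∸ j)) (≡.cong suc (ℕ.m+[n∸m]≡n j≤n)))))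

module SeriesRing {c ℓ} (R : CommutativeRing c ℓ) where
  open CommutativeRing R
  open PS R
  open FiniteSums R
  open import Relation.Binary.Reasoning.Setoid setoid

  -- A record rather than a pointwise Π-type, so that the series in an equation can be inferred.
  infix 4 _≋_
  record _≋_ (a b : Series) : Set ℓ where
    constructor coeffwise
    field coeff : ∀ n → a n ≈ b n
  open _≋_ public

  ⋆-comm : ∀ a b → (a ⋆ b) ≋ (b ⋆ a)
  ⋆-comm a b = coeffwise λ n → begin
    Σ≤ n (λ i → a i * b (n ∸ i))
      ≈⟨ Σ≤-reverse n _ ⟩
    Σ≤ n (λ i → a (n ∸ i) * b (n ∸ (n ∸ i)))
      ≈⟨ Σ≤-cong n (λ i i≤n → trans (*-comm _ _) (*-congʳ (reflexive (≡.cong b (ℕ.m∸[m∸n]≡n i≤n))))) ⟩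
    Σ≤ n (λ i → b i * a (n ∸ i))
      ∎

  ⋆-assoc : ∀ a b d → ((a ⋆ b) ⋆ d) ≋ (a ⋆ (b ⋆ d))
  ⋆-assoc a b d = coeffwise λ n → begin
    Σ≤ n (λ i → Σ≤ i (λ j → a j * b (i ∸ j)) * d (n ∸ i))        ≈⟨ Σ≤-cong n (λ i _ → Σ≤-* i _ _) ⟩
    Σ≤ n (λ i → Σ≤ i (λ j → a j * b (i ∸ j) * d (n ∸ i)))        ≈⟨ Σ≤-Σ≤-swap n _ ⟩
    Σ≤ n (λ j → Σ≤ (n ∸ j) (λ m → a j * b ((j ℕ.+ m) ∸ j) * d (n ∸ (j ℕ.+ m))))
      ≈⟨ Σ≤-cong n (λ j _ → Σ≤-cong (n ∸ j) (λ m _ → trans (*-assoc _ _ _) (*-congˡ (*-cong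
           (reflexive (≡.cong b (ℕ.m+n∸m≡n j m))) (reflexive (≡.cong d (≡.sym (ℕ.∸-+-assoc n j m)))))))) ⟩
    Σ≤ n (λ j → Σ≤ (n ∸ j) (λ m → a j * (b m * d ((n ∸ j) ∸ m)))) ≈⟨ Σ≤-cong n (λ j _ → *-Σ≤ (n ∸ j) _ _) ⟨
    Σ≤ n (λ j → a j * Σ≤ (n ∸ j) (λ m → b m * d ((n ∸ j) ∸ m)))   ∎

  ⋆-distribʳ : ∀ a b d → ((b ⊕ d) ⋆ a) ≋ ((b ⋆ a) ⊕ (d ⋆ a))
  ⋆-distribʳ a b d = coeffwise λ n → trans (Σ≤-cong n (λ i _ → distribʳ _ _ _)) (Σ≤-+ n _ _)

  one-⋆ : ∀ a → (one ⋆ a) ≋ a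
  one-⋆ a = coeffwise λ
    { zero    → *-identityˡ _
    ; (suc n) → begin
        Σ≤ (suc n) (λ i → one i * a (suc n ∸ i))             ≈⟨ Σ≤-suc n _ ⟩
        1# * a (suc n) + Σ≤ n (λ i → 0# * a (n ∸ i))         ≈⟨ +-cong (*-identityˡ _) (Σ≤-zero n _ (λ i _ → zeroˡ _)) ⟩
        a (suc n) + 0#                                       ≈⟨ +-identityʳ _ ⟩
        a (suc n)                                            ∎ }

  open import Algebra.Structures _≋_ using (IsCommutativeRing)

  series-isCommutativeRing : IsCommutativeRing _⊕_ _⋆_ ⊝_ (λ _ → 0#) one
  series-isCommutativeRing = record
    { isRing = record
      { +-isAbelianGroup = record
        { isGroup = record
          { isMonoid = record
            { isSemigroup = record
              { isMagma = record
                { isEquivalence = record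
                  { refl  = coeffwise λ _ → refl
                  ; sym   = λ p → coeffwise λ n → sym (coeff p n)
                  ; trans = λ p q → coeffwise λ n → trans (coeff p n) (coeff q n) }
                ; ∙-cong = λ p q → coeffwise λ n → +-cong (coeff p n) (coeff q n) }
              ; assoc = λ a b d → coeffwise λ n → +-assoc (a n) (b n) (d n) }
            ; identity = (λ a → coeffwise λ n → +-identityˡ (a n)) , (λ a → coeffwise λ n → +-identityʳ (a n)) }
          ; inverse = (λ a → coeffwise λ n → -‿inverseˡ (a n)) , (λ a → coeffwise λ n → -‿inverseʳ (a n))
          ; ⁻¹-cong = λ p → coeffwise λ n → -‿cong (coeff p n) }
        ; comm = λ a b → coeffwise λ n → +-comm (a n) (b n) }
      ; *-cong = λ p q → coeffwise λ n → Σ≤-cong n (λ i _ → *-cong (coeff p i) (coeff q (n ∸ i)))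
      ; *-assoc = ⋆-assoc
      ; *-identity = one-⋆ , λ a → coeffwise λ n → trans (coeff (⋆-comm a one) n) (coeff (one-⋆ a) n)
      ; distrib = (λ a b d → coeffwise λ n → trans (coeff (⋆-comm a (b ⊕ d)) n) (trans (coeff (⋆-distribʳ a b d) n)
                      (+-cong (coeff (⋆-comm b a) n) (coeff (⋆-comm d a) n))))
                , ⋆-distribʳ }
    ; *-comm = ⋆-comm }

  seriesRing : CommutativeRing c ℓ
  seriesRing = record { isCommutativeRing = series-isCommutativeRing }

  module SR = CommutativeRing seriesRing

  open import Data.Maybe using (nothing)
  open import Algebra.Solver.Ring.NaturalCoefficients SR.commutativeSemiring (λ _ _ → nothing) public
    using (solve; _:=_; _:+_; _:*_; con)

  ⋆-congˡ : ∀ a {b d} → b ≋ d → (a ⋆ b) ≋ (a ⋆ d)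
  ⋆-congˡ a = SR.*-congˡ {a}

  ⋆-congʳ : ∀ a {b d} → b ≋ d → (b ⋆ a) ≋ (d ⋆ a)
  ⋆-congʳ a = SR.*-congʳ {a}

  ^-cong : ∀ {a b} k → a ≋ b → (a ^[ k ]) ≋ (b ^[ k ])
  ^-cong zero    a≋b = SR.refl
  ^-cong (suc k) a≋b = SR.*-cong a≋b (^-cong k a≋b)

  ^-+ : ∀ a j k → (a ^[ j ℕ.+ k ]) ≋ ((a ^[ j ]) ⋆ (a ^[ k ]))
  ^-+ a zero    k = SR.sym (SR.*-identityˡ (a ^[ k ]))
  ^-+ a (suc j) k = SR.trans (⋆-congˡ a (^-+ a j k)) (SR.sym (SR.*-assoc a (a ^[ j ]) (a ^[ k ])))

  ^-⋆ : ∀ a b k → ((a ⋆ b) ^[ k ]) ≋ ((a ^[ k ]) ⋆ (b ^[ k ]))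
  ^-⋆ a b zero    = SR.sym (SR.*-identityˡ one)
  ^-⋆ a b (suc k) = SR.trans (⋆-congˡ (a ⋆ b) (^-⋆ a b k))
    (solve 4 (λ x y z w → (x :* y) :* (z :* w) := (x :* z) :* (y :* w)) SR.refl a b (a ^[ k ]) (b ^[ k ]))

  X⋆-zero : ∀ a → (X ⋆ a) 0 ≈ 0#
  X⋆-zero a = zeroˡ _

  X⋆-suc : ∀ a n → (X ⋆ a) (suc n) ≈ a n
  X⋆-suc a zero    = trans (+-cong (zeroˡ _) (*-identityˡ _)) (+-identityˡ _)
  X⋆-suc a (suc n) = begin
    Σ≤ (suc (suc n)) (λ i → X i * a (suc (suc n) ∸ i))                    ≈⟨ Σ≤-suc (suc n) _ ⟩
    0# * a (suc (suc n)) + Σ≤ (suc n) (λ i → X (suc i) * a (suc n ∸ i))  ≈⟨ +-cong (zeroˡ _) (Σ≤-suc n _) ⟩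
    0# + (1# * a (suc n) + Σ≤ n (λ i → 0# * a (n ∸ i)))                  ≈⟨ +-identityˡ _ ⟩
    1# * a (suc n) + Σ≤ n (λ i → 0# * a (n ∸ i))                         ≈⟨ +-cong (*-identityˡ _) (Σ≤-zero n _ (λ i _ → zeroˡ _)) ⟩
    a (suc n) + 0#                                                       ≈⟨ +-identityʳ _ ⟩
    a (suc n)                                                            ∎

  X^k⋆-below : ∀ k a n → n < k → ((X ^[ k ]) ⋆ a) n ≈ 0#
  X^k⋆-below (suc k) a zero    _         = trans (coeff (⋆-assoc X (X ^[ k ]) a) 0) (X⋆-zero ((X ^[ k ]) ⋆ a))
  X^k⋆-below (suc k) a (suc n) (s≤s n<k) =
    trans (coeff (⋆-assoc X (X ^[ k ]) a) (suc n)) (trans (X⋆-suc ((X ^[ k ]) ⋆ a) n) (X^k⋆-below k a n n<k))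

  X^k⋆-shift : ∀ k a n → ((X ^[ k ]) ⋆ a) (k ℕ.+ n) ≈ a n
  X^k⋆-shift zero    a n = coeff (one-⋆ a) n
  X^k⋆-shift (suc k) a n =
    trans (coeff (⋆-assoc X (X ^[ k ]) a) (suc (k ℕ.+ n))) (trans (X⋆-suc ((X ^[ k ]) ⋆ a) (k ℕ.+ n)) (X^k⋆-shift k a n))

  [X⋆a]^k⋆-below : ∀ a k b n → n < k → (((X ⋆ a) ^[ k ]) ⋆ b) n ≈ 0#
  [X⋆a]^k⋆-below a k b n n<k = begin
    (((X ⋆ a) ^[ k ]) ⋆ b) n              ≈⟨ coeff (⋆-congʳ b (^-⋆ X a k)) n ⟩
    (((X ^[ k ]) ⋆ (a ^[ k ])) ⋆ b) n     ≈⟨ coeff (⋆-assoc (X ^[ k ]) (a ^[ k ]) b) n ⟩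
    ((X ^[ k ]) ⋆ ((a ^[ k ]) ⋆ b)) n     ≈⟨ X^k⋆-below k ((a ^[ k ]) ⋆ b) n n<k ⟩
    0#                                    ∎

  ∘ₛ-⋆ : ∀ g a b n → ((g ∘ₛ (X ⋆ a)) ⋆ b) n ≈ Σ≤ n (λ j → g j * (((X ⋆ a) ^[ j ]) ⋆ b) n)
  ∘ₛ-⋆ g a b n = begin
    Σ≤ n (λ i → Σ≤ i (λ j → g j * (h ^[ j ]) i) * b (n ∸ i))
      ≈⟨ Σ≤-cong n (λ i _ → Σ≤-* i (b (n ∸ i)) _) ⟩
    Σ≤ n (λ i → Σ≤ i (λ j → g j * (h ^[ j ]) i * b (n ∸ i)))
      ≈⟨ Σ≤-Σ≤-swap n (λ i j → g j * (h ^[ j ]) i * b (n ∸ i)) ⟩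
    Σ≤ n (λ j → Σ≤ (n ∸ j) (λ m → g j * (h ^[ j ]) (j ℕ.+ m) * b (n ∸ (j ℕ.+ m))))
      ≈⟨ Σ≤-cong n term ⟩
    Σ≤ n (λ j → g j * ((h ^[ j ]) ⋆ b) n)
      ∎
    where
    h = X ⋆ a
    t : ℕ → ℕ → Carrier
    t j i = (h ^[ j ]) i * b (n ∸ i)
    term : ∀ j → j ≤ n → Σ≤ (n ∸ j) (λ m → g j * (h ^[ j ]) (j ℕ.+ m) * b (n ∸ (j ℕ.+ m))) ≈ g j * ((h ^[ j ]) ⋆ b) n
    term j j≤n = begin
      Σ≤ (n ∸ j) (λ m → g j * (h ^[ j ]) (j ℕ.+ m) * b (n ∸ (j ℕ.+ m)))  ≈⟨ Σ≤-cong (n ∸ j) (λ m _ → *-assoc (g j) _ _) ⟩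
      Σ≤ (n ∸ j) (λ m → g j * t j (j ℕ.+ m))                             ≈⟨ *-Σ≤ (n ∸ j) (g j) _ ⟨
      g j * Σ≤ (n ∸ j) (λ m → t j (j ℕ.+ m))                             ≈⟨ *-congˡ (Σ≤-dropLeading j (n ∸ j) (t j) vanish) ⟨
      g j * Σ≤ (j ℕ.+ (n ∸ j)) (t j)                                     ≈⟨ *-congˡ (reflexive (≡.cong (λ k → Σ≤ k (t j)) (ℕ.m+[n∸m]≡n j≤n))) ⟩
      g j * ((h ^[ j ]) ⋆ b) n                                           ∎
      where
      vanish : ∀ i → i < j → t j i ≈ 0#
      vanish i i<j = trans (*-congʳ (trans (sym (coeff (SR.*-identityʳ (h ^[ j ])) i)) ([X⋆a]^k⋆-below a j one i i<j))) (zeroˡ _)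

  open import Data.List using (_∷_; foldr; zipWith; map; upTo; applyUpTo)
  open import Data.List.Properties using (map-upTo)

  private
    invList≡applyUpTo : ∀ a n → invList a n ≡ applyUpTo (λ i → inv₁ a (n ∸ i)) (suc n)
    invList≡applyUpTo a zero    = ≡.refl
    invList≡applyUpTo a (suc n) = ≡.cong (inv₁ a (suc n) ∷_) (invList≡applyUpTo a n)

    zipWith-applyUpTo : ∀ n (f g : ℕ → Carrier) →
                        zipWith _*_ (applyUpTo f n) (applyUpTo g n) ≡ applyUpTo (λ i → f i * g i) n
    zipWith-applyUpTo zero    f g = ≡.refl
    zipWith-applyUpTo (suc n) f g = ≡.cong (f 0 * g 0 ∷_) (zipWith-applyUpTo n (λ i → f (suc i)) (λ i → g (suc i)))

    foldr-applyUpTo : ∀ n (f : ℕ → Carrier) → foldr _+_ 0# (applyUpTo f (suc n)) ≈ Σ≤ n f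
    foldr-applyUpTo zero    f = +-identityʳ _
    foldr-applyUpTo (suc n) f = trans (+-congˡ (foldr-applyUpTo n (λ i → f (suc i)))) (sym (Σ≤-suc n f))

  inv₁-suc : ∀ a n → inv₁ a (suc n) ≈ - Σ≤ n (λ i → a (suc i) * inv₁ a (n ∸ i))
  inv₁-suc a n = -‿cong (begin
    foldr _+_ 0# (zipWith _*_ (map (λ i → a (suc i)) (upTo (suc n))) (invList a n))
      ≡⟨ ≡.cong₂ (λ l l' → foldr _+_ 0# (zipWith _*_ l l')) (map-upTo (λ i → a (suc i)) (suc n)) (invList≡applyUpTo a n) ⟩
    foldr _+_ 0# (zipWith _*_ (applyUpTo (λ i → a (suc i)) (suc n)) (applyUpTo (λ i → inv₁ a (n ∸ i)) (suc n)))
      ≡⟨ ≡.cong (foldr _+_ 0#) (zipWith-applyUpTo (suc n) (λ i → a (suc i)) (λ i → inv₁ a (n ∸ i))) ⟩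
    foldr _+_ 0# (applyUpTo (λ i → a (suc i) * inv₁ a (n ∸ i)) (suc n))
      ≈⟨ foldr-applyUpTo n _ ⟩
    Σ≤ n (λ i → a (suc i) * inv₁ a (n ∸ i)) ∎)

  ⋆-inv₁ : ∀ a → a 0 ≈ 1# → (a ⋆ inv₁ a) ≋ one
  ⋆-inv₁ a a₀≈1 = coeffwise λ
    { zero    → trans (*-congʳ a₀≈1) (*-identityˡ 1#)
    ; (suc n) → begin
        Σ≤ (suc n) (λ i → a i * inv₁ a (suc n ∸ i))       ≈⟨ Σ≤-suc n _ ⟩
        a 0 * inv₁ a (suc n) + s n                          ≈⟨ +-congʳ (*-cong a₀≈1 (inv₁-suc a n)) ⟩
        1# * (- s n) + s n                                  ≈⟨ +-congʳ (*-identityˡ _) ⟩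
        - s n + s n                                         ≈⟨ -‿inverseˡ _ ⟩
        0#                                                  ∎ }
    where
    s : ℕ → Carrier
    s n = Σ≤ n (λ i → a (suc i) * inv₁ a (n ∸ i))

  fromℕ-+ : ∀ m n → fromℕ (m ℕ.+ n) ≈ fromℕ m + fromℕ n
  fromℕ-+ zero    n = sym (+-identityˡ _)
  fromℕ-+ (suc m) n = trans (+-congˡ (fromℕ-+ m n)) (sym (+-assoc 1# (fromℕ m) (fromℕ n)))

  fromℕ-* : ∀ m n → fromℕ (m ℕ.* n) ≈ fromℕ m * fromℕ n
  fromℕ-* zero    n = sym (zeroˡ _)
  fromℕ-* (suc m) n = begin
    fromℕ (n ℕ.+ m ℕ.* n)                ≈⟨ fromℕ-+ n (m ℕ.* n) ⟩
    fromℕ n + fromℕ (m ℕ.* n)            ≈⟨ +-cong (sym (*-identityˡ _)) (fromℕ-* m n) ⟩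
    1# * fromℕ n + fromℕ m * fromℕ n     ≈⟨ distribʳ _ _ _ ⟨
    (1# + fromℕ m) * fromℕ n             ∎

module CatalanCoefficients {c ℓ} (R : CommutativeRing c ℓ) where
  open CommutativeRing R
  open PS R
  open FiniteSums R
  open SeriesRing R
  open import Relation.Binary.Reasoning.Setoid setoid

  U : Series
  U = X ⋆ cS

  fromℕ-∑≤ : ∀ n f → fromℕ (CatalanNumbers.∑≤ n f) ≈ Σ≤ n (λ i → fromℕ (f i))
  fromℕ-∑≤ zero    f = refl
  fromℕ-∑≤ (suc n) f = trans (fromℕ-+ (CatalanNumbers.∑≤ n f) (f (suc n))) (+-congʳ (fromℕ-∑≤ n f))

  c≋1+Xc² : cS ≋ (one ⊕ (X ⋆ (cS ⋆ cS)))
  c≋1+Xc² = coeffwise λ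
    { zero    → +-congˡ (sym (X⋆-zero (cS ⋆ cS)))
    ; (suc n) → begin
        fromℕ (catalan (suc n))                                   ≡⟨ ≡.cong fromℕ (CatalanNumbers.segner n) ⟨
        fromℕ (CatalanNumbers.catalan⋆catalan n)
                                                                  ≈⟨ fromℕ-∑≤ n _ ⟩
        Σ≤ n (λ i → fromℕ (catalan i ℕ.* catalan (n ∸ i)))        ≈⟨ Σ≤-cong n (λ i _ → fromℕ-* (catalan i) (catalan (n ∸ i))) ⟩
        (cS ⋆ cS) n                                               ≈⟨ X⋆-suc (cS ⋆ cS) n ⟨
        (X ⋆ (cS ⋆ cS)) (suc n)                                   ≈⟨ +-identityˡ _ ⟨
        0# + (X ⋆ (cS ⋆ cS)) (suc n)                              ∎ }

  √1-4x+2U≋1 : (sqrt1m4x ⊕ (U ⊕ U)) ≋ one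
  √1-4x+2U≋1 = coeffwise λ
    { zero    → trans (+-congˡ (trans (+-cong (X⋆-zero cS) (X⋆-zero cS)) (+-identityʳ 0#))) (+-identityʳ 1#)
    ; (suc n) → begin
        - fromℕ (2 ℕ.* catalan n) + (U (suc n) + U (suc n))    ≈⟨ +-cong (-‿cong (fromℕ-2* (catalan n))) (+-cong (X⋆-suc cS n) (X⋆-suc cS n)) ⟩
        - (cS n + cS n) + (cS n + cS n)                        ≈⟨ -‿inverseˡ _ ⟩
        0#                                                     ∎ }
    where
    fromℕ-2* : ∀ m → fromℕ (2 ℕ.* m) ≈ fromℕ m + fromℕ m
    fromℕ-2* m = trans (fromℕ-+ m (m ℕ.+ 0)) (+-congˡ (trans (fromℕ-+ m 0) (+-identityʳ _)))

module SeriesIdentities {c ℓ} (R : CommutativeRing c ℓ) where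
  open CommutativeRing R using (1#; trans; +-congˡ; +-identityʳ; *-identityʳ; ring)
  open import Algebra.Properties.Ring ring using (-0#≈0#)
  open PS R
  open SeriesRing R
  open CatalanCoefficients R
  open import Relation.Binary.Reasoning.Setoid SR.setoid

  I : Series
  I = inv₁ (cS ⋆ sqrt1m4x)

  ⋆-cancelʳ : ∀ {a d x y} → (a ⋆ d) ≋ one → (x ⋆ a) ≋ (y ⋆ a) → x ≋ y
  ⋆-cancelʳ {a} {d} {x} {y} a⋆d≋1 x⋆a≋y⋆a = begin
    x                ≈⟨ SR.*-identityʳ x ⟨
    x ⋆ one          ≈⟨ ⋆-congˡ x a⋆d≋1 ⟨
    x ⋆ (a ⋆ d)      ≈⟨ SR.*-assoc x a d ⟨
    (x ⋆ a) ⋆ d      ≈⟨ ⋆-congʳ d x⋆a≋y⋆a ⟩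
    (y ⋆ a) ⋆ d      ≈⟨ SR.*-assoc y a d ⟩
    y ⋆ (a ⋆ d)      ≈⟨ ⋆-congˡ y a⋆d≋1 ⟩
    y ⋆ one          ≈⟨ SR.*-identityʳ y ⟩
    y                ∎

  c⋆√1-4x⋆I≋1 : ((cS ⋆ sqrt1m4x) ⋆ I) ≋ one
  c⋆√1-4x⋆I≋1 = ⋆-inv₁ (cS ⋆ sqrt1m4x) (trans (*-identityʳ _) (+-identityʳ 1#))

  U⋆U+X≋U : ((U ⋆ U) ⊕ X) ≋ U
  U⋆U+X≋U = begin
    (U ⋆ U) ⊕ X                       ≈⟨ solve 2 (λ x y → (x :* y) :* (x :* y) :+ x := x :* (con 1 :+ x :* (y :* y))) SR.refl X cS ⟩
    X ⋆ (one ⊕ (X ⋆ (cS ⋆ cS)))       ≈⟨ ⋆-congˡ X c≋1+Xc² ⟨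
    U                                 ∎

  c≋1+U⋆c : cS ≋ (one ⊕ (U ⋆ cS))
  c≋1+U⋆c = SR.trans c≋1+Xc² (solve 2 (λ x y → con 1 :+ x :* (y :* y) := con 1 :+ (x :* y) :* y) SR.refl X cS)

  I⋆√1-4x+U≋1 : ((I ⋆ sqrt1m4x) ⊕ U) ≋ one
  I⋆√1-4x+U≋1 = ⋆-cancelʳ {d = inv₁ cS} c⋆c⁻¹≋1 (begin
    ((I ⋆ sqrt1m4x) ⊕ U) ⋆ cS           ≈⟨ solve 4 (λ i s u y → (i :* s :+ u) :* y := (y :* s) :* i :+ u :* y) SR.refl I sqrt1m4x U cS ⟩
    ((cS ⋆ sqrt1m4x) ⋆ I) ⊕ (U ⋆ cS)     ≈⟨ SR.+-congʳ c⋆√1-4x⋆I≋1 ⟩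
    one ⊕ (U ⋆ cS)                       ≈⟨ c≋1+U⋆c ⟨
    cS                                   ≈⟨ SR.*-identityˡ cS ⟨
    one ⋆ cS                             ∎)
    where
    c⋆c⁻¹≋1 : (cS ⋆ inv₁ cS) ≋ one
    c⋆c⁻¹≋1 = ⋆-inv₁ cS (+-identityʳ 1#)

  I+U≋1+2U⋆I : (I ⊕ U) ≋ (one ⊕ ((U ⋆ I) ⊕ (U ⋆ I)))
  I+U≋1+2U⋆I = begin
    I ⊕ U
      ≈⟨ SR.+-congʳ (SR.*-identityʳ I) ⟨
    (I ⋆ one) ⊕ U
      ≈⟨ SR.+-congʳ (⋆-congˡ I √1-4x+2U≋1) ⟨
    (I ⋆ (sqrt1m4x ⊕ (U ⊕ U))) ⊕ U
      ≈⟨ solve 3 (λ i s u → i :* (s :+ (u :+ u)) :+ u := (i :* s :+ u) :+ (u :* i :+ u :* i)) SR.refl I sqrt1m4x U ⟩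
    ((I ⋆ sqrt1m4x) ⊕ U) ⊕ ((U ⋆ I) ⊕ (U ⋆ I))
      ≈⟨ SR.+-congʳ I⋆√1-4x+U≋1 ⟩
    one ⊕ ((U ⋆ I) ⊕ (U ⋆ I))
      ∎

  U^[2+m]⋆I+X⋆U^m⋆I≋U^[1+m]⋆I : ∀ m → (((U ^[ suc (suc m) ]) ⋆ I) ⊕ (X ⋆ ((U ^[ m ]) ⋆ I))) ≋ ((U ^[ suc m ]) ⋆ I)
  U^[2+m]⋆I+X⋆U^m⋆I≋U^[1+m]⋆I m = begin
    ((U ^[ suc (suc m) ]) ⋆ I) ⊕ (X ⋆ ((U ^[ m ]) ⋆ I))
      ≈⟨ solve 4 (λ u p i x → (u :* (u :* p)) :* i :+ x :* (p :* i) := ((u :* u :+ x) :* p) :* i) SR.refl U (U ^[ m ]) I X ⟩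
    (((U ⋆ U) ⊕ X) ⋆ (U ^[ m ])) ⋆ I
      ≈⟨ ⋆-congʳ I (⋆-congʳ (U ^[ m ]) U⋆U+X≋U) ⟩
    (U ^[ suc m ]) ⋆ I ∎

  U^[k+k]≋X^k⋆[X⋆c⋆c]^k : ∀ k → (U ^[ k ℕ.+ k ]) ≋ ((X ^[ k ]) ⋆ ((X ⋆ (cS ⋆ cS)) ^[ k ]))
  U^[k+k]≋X^k⋆[X⋆c⋆c]^k k = begin
    U ^[ k ℕ.+ k ]                            ≈⟨ ^-+ U k k ⟩
    (U ^[ k ]) ⋆ (U ^[ k ])                   ≈⟨ ^-⋆ U U k ⟨
    (U ⋆ U) ^[ k ]                            ≈⟨ ^-cong k (solve 2 (λ x y → (x :* y) :* (x :* y) := x :* (x :* (y :* y))) SR.refl X cS) ⟩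
    (X ⋆ (X ⋆ (cS ⋆ cS))) ^[ k ]              ≈⟨ ^-⋆ X (X ⋆ (cS ⋆ cS)) k ⟩
    (X ^[ k ]) ⋆ ((X ⋆ (cS ⋆ cS)) ^[ k ])     ∎

  1/[1-x]≋1+X⋆1/[1-x] : inv₁ (one ⊕ (⊝ X)) ≋ (one ⊕ (X ⋆ inv₁ (one ⊕ (⊝ X))))
  1/[1-x]≋1+X⋆1/[1-x] = begin
    J                                  ≈⟨ SR.*-identityˡ J ⟨
    one ⋆ J                            ≈⟨ ⋆-congʳ J (SR.trans (SR.+-congˡ (SR.-‿inverseˡ X)) (SR.+-identityʳ one)) ⟨
    (one ⊕ ((⊝ X) ⊕ X)) ⋆ J            ≈⟨ solve 3 (λ y x j → (con 1 :+ (y :+ x)) :* j := (con 1 :+ y) :* j :+ x :* j) SR.refl (⊝ X) X J ⟩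
    ((one ⊕ (⊝ X)) ⋆ J) ⊕ (X ⋆ J)      ≈⟨ SR.+-congʳ (⋆-inv₁ (one ⊕ (⊝ X)) (trans (+-congˡ -0#≈0#) (+-identityʳ 1#))) ⟩
    one ⊕ (X ⋆ J)                      ∎
    where J = inv₁ (one ⊕ (⊝ X))

  f^[1+k]≋X⋆f^k+X⋆f^[1+k] : ∀ k → (xOver1mx ^[ suc k ]) ≋ ((X ⋆ (xOver1mx ^[ k ])) ⊕ (X ⋆ (xOver1mx ^[ suc k ])))
  f^[1+k]≋X⋆f^k+X⋆f^[1+k] k = begin
    (X ⋆ J) ⋆ f^k
      ≈⟨ ⋆-congʳ f^k (⋆-congˡ X 1/[1-x]≋1+X⋆1/[1-x]) ⟩
    (X ⋆ (one ⊕ (X ⋆ J))) ⋆ f^k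
      ≈⟨ solve 3 (λ x j p → (x :* (con 1 :+ x :* j)) :* p := x :* p :+ x :* ((x :* j) :* p)) SR.refl X J f^k ⟩
    (X ⋆ f^k) ⊕ (X ⋆ ((X ⋆ J) ⋆ f^k))
      ∎
    where
    J = inv₁ (one ⊕ (⊝ X))
    f^k = xOver1mx ^[ k ]

module RiordanHalves {c ℓ} (R : CommutativeRing c ℓ) where
  open CommutativeRing R
  open PS R
  open FiniteSums R
  open SeriesRing R
  open CatalanCoefficients R using (U)
  open SeriesIdentities R
  open import Algebra.Properties.Group +-group using (∙-cancelʳ)
  open import Relation.Binary.Reasoning.Setoid setoid

  f : Series
  f = xOver1mx

  f^[1+k]-zero : ∀ k → (f ^[ suc k ]) 0 ≈ 0#
  f^[1+k]-zero k = trans (coeff (f^[1+k]≋X⋆f^k+X⋆f^[1+k] k) 0)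
                         (trans (+-cong (X⋆-zero (f ^[ k ])) (X⋆-zero (f ^[ suc k ]))) (+-identityʳ 0#))

  f^[1+k]-suc : ∀ k i → (f ^[ suc k ]) (suc i) ≈ (f ^[ k ]) i + (f ^[ suc k ]) i
  f^[1+k]-suc k i = trans (coeff (f^[1+k]≋X⋆f^k+X⋆f^[1+k] k) (suc i))
                          (+-cong (X⋆-suc (f ^[ k ]) i) (X⋆-suc (f ^[ suc k ]) i))

  f^[1+k]≈binomial : ∀ k i → (f ^[ suc k ]) (suc i) ≈ fromℕ (i C k)
  f^[1+k]≈binomial zero    zero    = trans (f^[1+k]-suc 0 0) (+-congˡ (f^[1+k]-zero 0))
  f^[1+k]≈binomial (suc k) zero    = trans (f^[1+k]-suc (suc k) 0) (trans (+-cong (f^[1+k]-zero k) (f^[1+k]-zero (suc k))) (+-identityʳ 0#))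
  f^[1+k]≈binomial zero    (suc i) = trans (f^[1+k]-suc 0 (suc i)) (trans (+-identityˡ _) (f^[1+k]≈binomial 0 i))
  f^[1+k]≈binomial (suc k) (suc i) = begin
    (f ^[ 2 ℕ.+ k ]) (2 ℕ.+ i)                         ≈⟨ f^[1+k]-suc (suc k) (suc i) ⟩
    (f ^[ suc k ]) (suc i) + (f ^[ 2 ℕ.+ k ]) (suc i)  ≈⟨ +-cong (f^[1+k]≈binomial k i) (f^[1+k]≈binomial (suc k) i) ⟩
    fromℕ (i C k) + fromℕ (i C suc k)                  ≈⟨ fromℕ-+ (i C k) (i C suc k) ⟨
    fromℕ (i C k ℕ.+ i C suc k)                        ≡⟨ ≡.cong fromℕ (nCk+nC[k+1]≡[n+1]C[k+1] i k) ⟩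
    fromℕ (suc i C suc k)                              ∎

  E : ℕ → Series
  E m = (U ^[ m ]) ⋆ I

  E-below : ∀ m n → n < m → E m n ≈ 0#
  E-below m n n<m = [X⋆a]^k⋆-below cS m I n n<m

  E-recurrence : ∀ m n → E (suc m) (suc n) ≈ E (suc (suc m)) (suc n) + E m n
  E-recurrence m n = begin
    E (suc m) (suc n)                              ≈⟨ coeff (U^[2+m]⋆I+X⋆U^m⋆I≋U^[1+m]⋆I m) (suc n) ⟨
    E (suc (suc m)) (suc n) + (X ⋆ E m) (suc n)    ≈⟨ +-congˡ (X⋆-suc (E m) n) ⟩
    E (suc (suc m)) (suc n) + E m n                ∎

  E₀+catalan≈E₁+E₁ : ∀ n → E 0 (suc n) + fromℕ (catalan n) ≈ E 1 (suc n) + E 1 (suc n)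
  E₀+catalan≈E₁+E₁ n = begin
    E 0 (suc n) + fromℕ (catalan n)                   ≈⟨ +-cong (coeff (one-⋆ I) (suc n)) (sym (X⋆-suc cS n)) ⟩
    I (suc n) + U (suc n)                             ≈⟨ coeff I+U≋1+2U⋆I (suc n) ⟩
    0# + ((U ⋆ I) (suc n) + (U ⋆ I) (suc n))          ≈⟨ +-identityˡ _ ⟩
    (U ⋆ I) (suc n) + (U ⋆ I) (suc n)                 ≈⟨ +-cong U⋆I≈E₁ U⋆I≈E₁ ⟩
    E 1 (suc n) + E 1 (suc n)                         ∎
    where
    U⋆I≈E₁ : (U ⋆ I) (suc n) ≈ E 1 (suc n)
    U⋆I≈E₁ = coeff (⋆-congʳ I (SR.sym (SR.*-identityʳ U))) (suc n)

  f^[1+n]-middle : ∀ n → (f ^[ suc n ]) (suc (suc (2 ℕ.* n))) + fromℕ (catalan n)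
                         ≈ (f ^[ suc n ]) (suc (2 ℕ.* n)) + (f ^[ suc n ]) (suc (2 ℕ.* n))
  f^[1+n]-middle n = begin
    (f ^[ suc n ]) (suc (suc (2 ℕ.* n))) + fromℕ (catalan n)  ≈⟨ +-congʳ (f^[1+k]≈binomial n (suc (2 ℕ.* n))) ⟩
    fromℕ (suc (2 ℕ.* n) C n) + fromℕ (catalan n)             ≈⟨ fromℕ-+ (suc (2 ℕ.* n) C n) (catalan n) ⟨
    fromℕ (suc (2 ℕ.* n) C n ℕ.+ catalan n)                   ≡⟨ ≡.cong fromℕ (CatalanNumbers.[1+2n]Cn+catalan≡[2n]Cn+[2n]Cn n) ⟩
    fromℕ ((2 ℕ.* n) C n ℕ.+ (2 ℕ.* n) C n)                   ≈⟨ fromℕ-+ ((2 ℕ.* n) C n) ((2 ℕ.* n) C n) ⟩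
    fromℕ ((2 ℕ.* n) C n) + fromℕ ((2 ℕ.* n) C n)             ≈⟨ +-cong (f^[1+k]≈binomial n (2 ℕ.* n)) (f^[1+k]≈binomial n (2 ℕ.* n)) ⟨
    (f ^[ suc n ]) (suc (2 ℕ.* n)) + (f ^[ suc n ]) (suc (2 ℕ.* n)) ∎

  -- Stated for a variable i so that E≈f^[n] below recurses structurally on i.
  E₀≈f^[1+n] : ∀ n i → i ≡ suc (2 ℕ.* n) → E 1 (suc n) ≈ (f ^[ suc n ]) i → E 0 (suc n) ≈ (f ^[ suc n ]) (suc i)
  E₀≈f^[1+n] n _ ≡.refl E₁≈f = ∙-cancelʳ (fromℕ (catalan n)) _ _ (begin
    E 0 (suc n) + fromℕ (catalan n)                                   ≈⟨ E₀+catalan≈E₁+E₁ n ⟩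
    E 1 (suc n) + E 1 (suc n)                                         ≈⟨ +-cong E₁≈f E₁≈f ⟩
    (f ^[ suc n ]) (suc (2 ℕ.* n)) + (f ^[ suc n ]) (suc (2 ℕ.* n))   ≈⟨ f^[1+n]-middle n ⟨
    (f ^[ suc n ]) (suc (suc (2 ℕ.* n))) + fromℕ (catalan n)          ∎)

  E≈f^[n] : ∀ n m i → m ℕ.+ i ≡ 2 ℕ.* n → E m n ≈ (f ^[ n ]) i
  E≈f^[n] zero    zero    zero    _  = *-identityˡ 1#
  E≈f^[n] (suc n) m       zero    eq = trans (E-below m (suc n) 1+n<m) (sym (f^[1+k]-zero n))
    where
    1+n<m : suc n < m
    1+n<m = ≡.subst (suc n <_) (≡.trans (≡.sym eq) (ℕ.+-identityʳ m)) (ℕ.m<m+n (suc n) (s≤s z≤n))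
  E≈f^[n] (suc n) zero    (suc i) eq = E₀≈f^[1+n] n i (ℕ.suc-injective (≡.trans eq (ℕ.*-suc 2 n))) (E≈f^[n] (suc n) 1 i eq)
  E≈f^[n] (suc n) (suc m) (suc i) eq = begin
    E (suc m) (suc n)                            ≈⟨ E-recurrence m n ⟩
    E (suc (suc m)) (suc n) + E m n              ≈⟨ +-cong (E≈f^[n] (suc n) (suc (suc m)) i eq₁) (E≈f^[n] n m i eq₂) ⟩
    (f ^[ suc n ]) i + (f ^[ n ]) i              ≈⟨ +-comm _ _ ⟩
    (f ^[ n ]) i + (f ^[ suc n ]) i              ≈⟨ f^[1+k]-suc n i ⟨
    (f ^[ suc n ]) (suc i)                       ∎
    where
    eq₁ : suc (suc m) ℕ.+ i ≡ 2 ℕ.* suc n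
    eq₁ = ≡.trans (≡.sym (ℕ.+-suc (suc m) i)) eq
    eq₂ : m ℕ.+ i ≡ 2 ℕ.* n
    eq₂ = ℕ.suc-injective (ℕ.suc-injective (≡.trans (≡.cong suc (≡.sym (ℕ.+-suc m i))) (≡.trans eq (ℕ.*-suc 2 n))))

  U^j⋆[I⋆U^k]≋E[j+k] : ∀ j k → ((U ^[ j ]) ⋆ (I ⋆ (U ^[ k ]))) ≋ E (j ℕ.+ k)
  U^j⋆[I⋆U^k]≋E[j+k] j k =
    SR.trans (solve 3 (λ a i b → a :* (i :* b) := (a :* b) :* i) SR.refl (U ^[ j ]) I (U ^[ k ]))
             (⋆-congʳ I (SR.sym (^-+ U j k)))

  dV⋆U^k : ∀ g k n → (dV g ⋆ (U ^[ k ])) n ≈ Σ≤ n (λ j → g j * E (j ℕ.+ k) n)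
  dV⋆U^k g k n = begin
    ((G ⋆ I) ⋆ (U ^[ k ])) n                          ≈⟨ coeff (⋆-assoc G I (U ^[ k ])) n ⟩
    (G ⋆ (I ⋆ (U ^[ k ]))) n                          ≈⟨ ∘ₛ-⋆ g cS (I ⋆ (U ^[ k ])) n ⟩
    Σ≤ n (λ j → g j * ((U ^[ j ]) ⋆ (I ⋆ (U ^[ k ]))) n) ≈⟨ Σ≤-cong n (λ j _ → *-congˡ (coeff (U^j⋆[I⋆U^k]≋E[j+k] j k) n)) ⟩
    Σ≤ n (λ j → g j * E (j ℕ.+ k) n)                 ∎
    where G = g ∘ₛ U

  vertical-term-vanish : ∀ (g : Series) n k j → n < j ℕ.+ k → g j * E (j ℕ.+ k) n ≈ 0#
  vertical-term-vanish g n k j n<j+k = trans (*-congˡ (E-below (j ℕ.+ k) n n<j+k)) (zeroʳ (g j))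

  vertical-entry : ∀ g n k → k ≤ 2 ℕ.* n → (g ⋆ (f ^[ n ])) (2 ℕ.* n ∸ k) ≈ (dV g ⋆ (U ^[ k ])) n
  vertical-entry g n k k≤2n = begin
    Σ≤ (2 ℕ.* n ∸ k) (λ i → g i * (f ^[ n ]) ((2 ℕ.* n ∸ k) ∸ i))
      ≈⟨ Σ≤-cong (2 ℕ.* n ∸ k) (λ i i≤ → *-congˡ (sym (E≈f^[n] n (i ℕ.+ k) _ (indices i≤)))) ⟩
    Σ≤ (2 ℕ.* n ∸ k) t
      ≈⟨ Σ≤-truncate t vanish (ℕ.≤⇒≤′ (ℕ.∸-monoˡ-≤ k (ℕ.m≤n*m n 2))) ⟩
    Σ≤ (n ∸ k) t
      ≈⟨ Σ≤-truncate t vanish (ℕ.≤⇒≤′ (ℕ.m∸n≤m n k)) ⟨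
    Σ≤ n t
      ≈⟨ dV⋆U^k g k n ⟨
    (dV g ⋆ (U ^[ k ])) n
      ∎
    where
    t : ℕ → Carrier
    t j = g j * E (j ℕ.+ k) n
    indices : ∀ {i} → i ≤ 2 ℕ.* n ∸ k → (i ℕ.+ k) ℕ.+ ((2 ℕ.* n ∸ k) ∸ i) ≡ 2 ℕ.* n
    indices {i} i≤ = ≡.trans (ℕ.+-assoc i k _) (≡.trans (ℕ.+-comm i _) (≡.trans (ℕ.+-assoc k _ i)
      (≡.trans (≡.cong (k ℕ.+_) (ℕ.m∸n+n≡m i≤)) (ℕ.m+[n∸m]≡n k≤2n))))
    vanish : ∀ i → n ∸ k < i → t i ≈ 0#
    vanish i n∸k<i = vertical-term-vanish g n k i (ℕ.≰⇒> (λ i+k≤n → ℕ.<⇒≱ n∸k<i (ℕ.m+n≤o⇒m≤o∸n i i+k≤n)))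

  vertical-beyond : ∀ g n k → 2 ℕ.* n < k → (dV g ⋆ (U ^[ k ])) n ≈ 0#
  vertical-beyond g n k 2n<k = trans (dV⋆U^k g k n) (Σ≤-zero n _ (λ j _ → vertical-term-vanish g n k j n<j+k))
    where
    n<j+k : ∀ {j} → n < j ℕ.+ k
    n<j+k {j} = ℕ.<-≤-trans (ℕ.≤-<-trans (ℕ.m≤n*m n 2) 2n<k) (ℕ.m≤n+m k j)

  vertical-half : ∀ g → vhalf (riordan g f) ≈ₘ riordan (dV g) U
  vertical-half g n k with k ℕ.≤ᵇ 2 ℕ.* n | ℕ.≤ᵇ-reflects-≤ k (2 ℕ.* n)
  ... | true  | ofʸ k≤2n = vertical-entry g n k k≤2n
  ... | false | ofⁿ k≰2n = sym (vertical-beyond g n k (ℕ.≰⇒> k≰2n))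

  horizontal-half : ∀ g → hhalf (riordan g f) ≈ₘ riordan (dV g) (X ⋆ (cS ⋆ cS))
  horizontal-half g n k = begin
    (g ⋆ (f ^[ n ℕ.+ k ])) (2 ℕ.* n)
      ≡⟨ ≡.cong (g ⋆ (f ^[ n ℕ.+ k ])) 2n≡2[n+k]∸2k ⟩
    (g ⋆ (f ^[ n ℕ.+ k ])) (2 ℕ.* (n ℕ.+ k) ∸ (k ℕ.+ k))
      ≈⟨ vertical-entry g (n ℕ.+ k) (k ℕ.+ k) 2k≤2[n+k] ⟩
    (dV g ⋆ (U ^[ k ℕ.+ k ])) (n ℕ.+ k)
      ≈⟨ coeff (⋆-congˡ (dV g) (U^[k+k]≋X^k⋆[X⋆c⋆c]^k k)) (n ℕ.+ k) ⟩
    (dV g ⋆ ((X ^[ k ]) ⋆ (W ^[ k ]))) (n ℕ.+ k)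
      ≈⟨ coeff (solve 3 (λ a b d → a :* (b :* d) := b :* (a :* d)) SR.refl (dV g) (X ^[ k ]) (W ^[ k ])) (n ℕ.+ k) ⟩
    ((X ^[ k ]) ⋆ (dV g ⋆ (W ^[ k ]))) (n ℕ.+ k)
      ≡⟨ ≡.cong ((X ^[ k ]) ⋆ (dV g ⋆ (W ^[ k ]))) (ℕ.+-comm n k) ⟩
    ((X ^[ k ]) ⋆ (dV g ⋆ (W ^[ k ]))) (k ℕ.+ n)
      ≈⟨ X^k⋆-shift k (dV g ⋆ (W ^[ k ])) n ⟩
    (dV g ⋆ (W ^[ k ])) n
      ∎
    where
    W = X ⋆ (cS ⋆ cS)
    2[n+k]≡2n+[k+k] : 2 ℕ.* (n ℕ.+ k) ≡ 2 ℕ.* n ℕ.+ (k ℕ.+ k)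
    2[n+k]≡2n+[k+k] = lemma n k
      where lemma : ∀ n k → 2 ℕ.* (n ℕ.+ k) ≡ 2 ℕ.* n ℕ.+ (k ℕ.+ k)
            lemma = solve-∀
    2n≡2[n+k]∸2k : 2 ℕ.* n ≡ 2 ℕ.* (n ℕ.+ k) ∸ (k ℕ.+ k)
    2n≡2[n+k]∸2k = ≡.sym (≡.trans (≡.cong (_∸ (k ℕ.+ k)) 2[n+k]≡2n+[k+k]) (ℕ.m+n∸n≡m (2 ℕ.* n) (k ℕ.+ k)))
    2k≤2[n+k] : k ℕ.+ k ≤ 2 ℕ.* (n ℕ.+ k)
    2k≤2[n+k] = ℕ.≤-trans (ℕ.m≤n+m (k ℕ.+ k) (2 ℕ.* n)) (ℕ.≤-reflexive (≡.sym 2[n+k]≡2n+[k+k]))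

open PS

-- The identities hold for every g; g 0 ≉ 0 only makes (g, x/(1-x)) a Riordan array.
mainTheorem9 : ∀ {c ℓ} (R : CommutativeRing c ℓ) (g : Series R) →
    ¬ (CommutativeRing._≈_ R (g 0) (CommutativeRing.0# R)) →
      _≈ₘ_ R (vhalf R (riordan R g (xOver1mx R))) (riordan R (dV R g) (_⋆_ R (X R) (cS R)))
      × _≈ₘ_ R (hhalf R (riordan R g (xOver1mx R))) (riordan R (dV R g) (_⋆_ R (X R) (_⋆_ R (cS R) (cS R))))
mainTheorem9 R g _ = RiordanHalves.vertical-half R g , RiordanHalves.horizontal-half R g
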